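{- Let $G$ be a non-cyclic finite abelian group with $\exp(G)=n$. Then the set $C_0(G)\cup\{\eta(G)\}$ does not contain $n+1$ consecutive integers.
   Context: A sequence over $G$ is a finite unordered list of elements of $G$ with repetition allowed; length counts multiplicity. A short zero-sum sequence is a sequence with sum $0$ and length in $[1,\exp(G)]$. $D(G)$ is the smallest $d$ such that every sequence over $G$ of length $\ge d$ has a nonempty zero-sum subsequence; $\eta(G)$ is the smallest $d$ such that every sequence of length $\ge d$ has a short zero-sum subsequence. $C_0(G)$ is the set of integers $t\in[D(G)+1,\eta(G)-1]$ such that every zero-sum sequence over $G$ of length exactly $t$ contains a short zero-sum subsequence. -}

module Defs where

open import Level using (Level; _⊔_)
open import Algebra.Bundles using (AbelianGroup)
open import Data.Nat using (ℕ; zero; suc; _≤_; _<_; _+_; _∸_)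
open import Data.List using (List; foldr; length)
open import Data.List.Relation.Unary.Any using (Any)
open import Data.List.Relation.Binary.Sublist.Propositional using (_⊆_)
open import Data.Product using (Σ; _×_; ∃)
open import Data.Sum using (_⊎_)
open import Relation.Nullary using (¬_)
open import Relation.Binary.PropositionalEquality using (_≡_)

module _ {c ℓ : Level} (G : AbelianGroup c ℓ) where
  open AbelianGroup G

  mul : ℕ → Carrier → Carrier
  mul zero    x = ε
  mul (suc k) x = x ∙ mul k x

  IsFinite : Set (c ⊔ ℓ)
  IsFinite = Σ (List Carrier) λ xs → ∀ x → Any (x ≈_) xs

  IsCyclic : Set (c ⊔ ℓ)
  IsCyclic = Σ Carrier λ g → ∀ x → ∃ λ k → x ≈ mul k g

  IsExponent : ℕ → Set (c ⊔ ℓ)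
  IsExponent n = (1 ≤ n) × (∀ x → mul n x ≈ ε)
               × (∀ m → 1 ≤ m → (∀ x → mul m x ≈ ε) → n ≤ m)

  -- sequences over G: lists (order irrelevant); subsequences: sublists
  Seq : Set c
  Seq = List Carrier

  σ : Seq → Carrier
  σ = foldr _∙_ ε

  IsZeroSum : Seq → Set ℓ
  IsZeroSum S = σ S ≈ ε

  HasNonemptyZeroSumSubseq : Seq → Set (c ⊔ ℓ)
  HasNonemptyZeroSumSubseq S =
    Σ Seq λ T → (T ⊆ S) × (1 ≤ length T) × IsZeroSum T

  HasShortZeroSumSubseq : ℕ → Seq → Set (c ⊔ ℓ)
  HasShortZeroSumSubseq n S =
    Σ Seq λ T → (T ⊆ S) × (1 ≤ length T) × (length T ≤ n) × IsZeroSum T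

  DProp : ℕ → Set (c ⊔ ℓ)
  DProp d = ∀ (S : Seq) → d ≤ length S → HasNonemptyZeroSumSubseq S

  IsDavenport : ℕ → Set (c ⊔ ℓ)
  IsDavenport d = DProp d × (∀ d′ → DProp d′ → d ≤ d′)

  EtaProp : ℕ → ℕ → Set (c ⊔ ℓ)
  EtaProp n d = ∀ (S : Seq) → d ≤ length S → HasShortZeroSumSubseq n S

  IsEta : ℕ → ℕ → Set (c ⊔ ℓ)
  IsEta n e = EtaProp n e × (∀ d′ → EtaProp n d′ → e ≤ d′)

  -- t ∈ C₀(G), given exp(G) = n, D(G) = d, η(G) = e
  InC₀ : (n d e t : ℕ) → Set (c ⊔ ℓ)
  InC₀ n d e t = (suc d ≤ t) × (t ≤ e ∸ 1)
               × (∀ (S : Seq) → length S ≡ t → IsZeroSum S → HasShortZeroSumSubseq n S)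

-- Suppose C₀(G) ∪ {η(G)} contains the window m, …, m + n, where n = exp(G).
-- Then every zero-sum sequence T with |T| ≥ m has a short zero-sum subsequence,
-- by strong induction on |T|: the window covers |T| ≤ m + n; otherwise merge two
-- terms of T and take a short zero-sum subsequence U of the result.  If U avoids
-- the merged term it lies in T; if not, removing its terms from T leaves a
-- zero-sum sequence of length ≥ |T| − n − 1 ≥ m, shorter than T.  The same removal, applied
-- to a sequence S of length η(G) − 1 extended by −σ(S), shows that η(G) − 1
-- already forces short zero-sum subsequences, contradicting the minimality of
-- η(G).
module Submission where

open import Defs
open import Level using (Level; _⊔_)
open import Algebra.Bundles using (AbelianGroup)
open import Data.Nat using (ℕ; _≤_; _+_)
open import Data.Product using (∃)
open import Data.Sum using (_⊎_)
open import Relation.Nullary using (¬_)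
open import Relation.Binary.PropositionalEquality using (_≡_)

open import Data.Nat using (zero; suc; _<_; _∸_; s≤s; s≤s⁻¹; z<s; _≤?_)
open import Data.Nat.Properties
open import Data.List using ([]; _∷_; length)
open import Data.List.Relation.Binary.Sublist.Propositional using (_⊆_; []; _∷_; _∷ʳ_; ⊆-refl; ⊆-trans)
open import Data.List.Relation.Binary.Sublist.Propositional.Properties using (length-mono-≤)
open import Data.Product using (Σ; _×_; _,_)
open import Data.Sum using (inj₁; inj₂; [_,_]′)
open import Data.Empty using (⊥-elim)
open import Function using (id)
open import Relation.Nullary using (yes; no)
import Algebra.Properties.Group as GroupProperties
import Relation.Binary.PropositionalEquality as ≡
import Relation.Binary.Reasoning.Setoid as SetoidReasoning

module _ {c ℓ : Level} (G : AbelianGroup c ℓ) where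
  open AbelianGroup G
  open GroupProperties group using (identityʳ-unique)
  open SetoidReasoning setoid

  ⊆-complement : ∀ {U xs : Seq G} → U ⊆ xs →
    Σ (Seq G) λ C → C ⊆ xs × length C + length U ≡ length xs × σ G xs ≈ σ G U ∙ σ G C
  ⊆-complement [] = [] , [] , ≡.refl , sym (identityˡ ε)
  ⊆-complement (_∷ʳ_ {xs} {ys} y U⊆ys) with ⊆-complement U⊆ys
  ... | C , C⊆ys , |C|+|U|≡|ys| , σys≈ = y ∷ C , ≡.refl ∷ C⊆ys , ≡.cong suc |C|+|U|≡|ys| , (begin
    y ∙ σ G ys             ≈⟨ ∙-congˡ σys≈ ⟩
    y ∙ (σ G xs ∙ σ G C)   ≈⟨ sym (assoc _ _ _) ⟩
    (y ∙ σ G xs) ∙ σ G C   ≈⟨ ∙-congʳ (comm _ _) ⟩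
    (σ G xs ∙ y) ∙ σ G C   ≈⟨ assoc _ _ _ ⟩
    σ G xs ∙ (y ∙ σ G C)   ∎)
  ⊆-complement (_∷_ {x} {xs} {_} {ys} ≡.refl U⊆ys) with ⊆-complement U⊆ys
  ... | C , C⊆ys , |C|+|U|≡|ys| , σys≈ =
    C , x ∷ʳ C⊆ys , ≡.trans (+-suc _ _) (≡.cong suc |C|+|U|≡|ys|) , (begin
    x ∙ σ G ys             ≈⟨ ∙-congˡ σys≈ ⟩
    x ∙ (σ G xs ∙ σ G C)   ≈⟨ sym (assoc _ _ _) ⟩
    (x ∙ σ G xs) ∙ σ G C   ∎)

  module _ (n : ℕ) where

    hasShortZeroSumSubseq-⊆ : ∀ {S T : Seq G} → S ⊆ T →
      HasShortZeroSumSubseq G n S → HasShortZeroSumSubseq G n T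
    hasShortZeroSumSubseq-⊆ S⊆T (U , U⊆S , short) = U , ⊆-trans U⊆S S⊆T , short

    LongZeroSumSubseq : Seq G → Set (c ⊔ ℓ)
    LongZeroSumSubseq xs =
      Σ (Seq G) λ C → C ⊆ xs × IsZeroSum G C × length xs < length C + n

    hasShortZeroSumSubseq-∷⁻ : ∀ {a} {xs : Seq G} → IsZeroSum G (a ∷ xs) →
      HasShortZeroSumSubseq G n (a ∷ xs) →
      HasShortZeroSumSubseq G n xs ⊎ LongZeroSumSubseq xs
    hasShortZeroSumSubseq-∷⁻ _ (U , _ ∷ʳ U⊆xs , short) = inj₁ (U , U⊆xs , short)
    hasShortZeroSumSubseq-∷⁻ {a} {xs} zero-a∷xs (_ ∷ U , ≡.refl ∷ U⊆xs , _ , |a∷U|≤n , zero-a∷U)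
      with ⊆-complement U⊆xs
    ... | C , C⊆xs , |C|+|U|≡|xs| , σxs≈ = inj₂ (C , C⊆xs , zero-C , |xs|<|C|+n)
      where
      zero-C : IsZeroSum G C
      zero-C = identityʳ-unique (a ∙ σ G U) (σ G C) (begin
        (a ∙ σ G U) ∙ σ G C   ≈⟨ assoc _ _ _ ⟩
        a ∙ (σ G U ∙ σ G C)   ≈⟨ ∙-congˡ (sym σxs≈) ⟩
        a ∙ σ G xs            ≈⟨ zero-a∷xs ⟩
        ε                     ≈⟨ sym zero-a∷U ⟩
        a ∙ σ G U             ∎)
      |xs|<|C|+n : length xs < length C + n
      |xs|<|C|+n = ≡.subst (_< length C + n) |C|+|U|≡|xs| (+-monoʳ-< (length C) |a∷U|≤n)

    ShortZeroSumWindow : ℕ → Set (c ⊔ ℓ)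
    ShortZeroSumWindow m = ∀ (T : Seq G) → m ≤ length T → length T ≤ m + n →
      IsZeroSum G T → HasShortZeroSumSubseq G n T

    ShortZeroSumFrom : ℕ → Set (c ⊔ ℓ)
    ShortZeroSumFrom m = ∀ (T : Seq G) → m ≤ length T →
      IsZeroSum G T → HasShortZeroSumSubseq G n T

    merge-step : ∀ {m} (T : Seq G) → 1 ≤ n → m + n < length T →
      (∀ T′ → length T′ < length T → m ≤ length T′ → IsZeroSum G T′ →
         HasShortZeroSumSubseq G n T′) →
      IsZeroSum G T → HasShortZeroSumSubseq G n T
    merge-step [] 1≤n () ih zero-T
    merge-step {m} (x ∷ []) 1≤n (s≤s m+n≤0) ih zero-T =
      ⊥-elim (<⇒≱ 1≤n (m+n≤o⇒n≤o m m+n≤0))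
    merge-step {m} (x₁ ∷ x₂ ∷ rest) 1≤n m+n<|T| ih zero-T =
      [ hasShortZeroSumSubseq-⊆ (x₁ ∷ʳ x₂ ∷ʳ ⊆-refl) , from-long ]′
        (hasShortZeroSumSubseq-∷⁻ zero-merged (ih merged ≤-refl m≤|merged| zero-merged))
      where
      merged : Seq G
      merged = x₁ ∙ x₂ ∷ rest
      m≤|merged| : m ≤ length merged
      m≤|merged| = m+n≤o⇒m≤o m (s≤s⁻¹ m+n<|T|)
      zero-merged : IsZeroSum G merged
      zero-merged = trans (assoc _ _ _) zero-T
      from-long : LongZeroSumSubseq rest → HasShortZeroSumSubseq G n (x₁ ∷ x₂ ∷ rest)
      from-long (C , C⊆rest , zero-C , |rest|<|C|+n) =
        hasShortZeroSumSubseq-⊆ (x₁ ∷ʳ x₂ ∷ʳ C⊆rest)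
          (ih C (s≤s (m≤n⇒m≤1+n (length-mono-≤ C⊆rest))) m≤|C| zero-C)
        where
        m≤|C| : m ≤ length C
        m≤|C| = +-cancelʳ-≤ n m (length C) (≤-trans (s≤s⁻¹ m+n<|T|) |rest|<|C|+n)

    window⇒from : ∀ {m} → 1 ≤ n → ShortZeroSumWindow m → ShortZeroSumFrom m
    window⇒from {m} 1≤n window T = bounded (suc (length T)) T ≤-refl
      where
      bounded : ∀ k (T : Seq G) → length T < k → m ≤ length T → IsZeroSum G T →
        HasShortZeroSumSubseq G n T
      bounded (suc k) T (s≤s |T|≤k) m≤|T| with length T ≤? m + n
      ... | yes |T|≤m+n = window T m≤|T| |T|≤m+n
      ... | no  |T|≰m+n = merge-step T 1≤n (≰⇒> |T|≰m+n)
              (λ T′ |T′|<|T| → bounded k T′ (<-≤-trans |T′|<|T| |T|≤k))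

    shortZeroSumFrom⇒etaProp-pred : ∀ {m e} → ShortZeroSumFrom m → m + n ≤ e →
      EtaProp G n e → EtaProp G n (e ∸ 1)
    shortZeroSumFrom⇒etaProp-pred {e = zero} _ _ eta = eta
    shortZeroSumFrom⇒etaProp-pred {m} {suc k} from m+n≤e eta S k≤|S| =
      [ id , from-long ]′
        (hasShortZeroSumSubseq-∷⁻ (inverseˡ (σ G S)) (eta (σ G S ⁻¹ ∷ S) (s≤s k≤|S|)))
      where
      from-long : LongZeroSumSubseq S → HasShortZeroSumSubseq G n S
      from-long (C , C⊆S , zero-C , |S|<|C|+n) =
        hasShortZeroSumSubseq-⊆ C⊆S (from C m≤|C| zero-C)
        where
        m≤|C| : m ≤ length C
        m≤|C| = +-cancelʳ-≤ n m (length C) (≤-trans m+n≤e (≤-trans (s≤s k≤|S|) |S|<|C|+n))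

proposition7p1 : ∀ {c ℓ : Level} (G : AbelianGroup c ℓ) →
    IsFinite G → ¬ IsCyclic G →
    ∀ (n d e : ℕ) → IsExponent G n → IsDavenport G d → IsEta G n e →
    ¬ (∃ λ m → ∀ i → i ≤ n → InC₀ G n d e (m + i) ⊎ m + i ≡ e)
proposition7p1 G _ _ n d e (1≤n , _) _ (eta , eta-minimal) (m , consecutive) =
  <⇒≱ (∸-monoʳ-< z<s 1≤e)
      (eta-minimal (e ∸ 1) (shortZeroSumFrom⇒etaProp-pred G n short-from m+n≤e eta))
  where
  m+n≤e : m + n ≤ e
  m+n≤e with consecutive n ≤-refl
  ... | inj₁ (_ , m+n≤e∸1 , _) = ≤-trans m+n≤e∸1 (m∸n≤m e 1)
  ... | inj₂ m+n≡e             = ≤-reflexive m+n≡e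

  1≤e : 1 ≤ e
  1≤e = ≤-trans 1≤n (≤-trans (m≤n+m n m) m+n≤e)

  ∸m≤n : ∀ {t} → t ≤ m + n → t ∸ m ≤ n
  ∸m≤n {t} t≤m+n = ≡.subst (t ∸ m ≤_) (m+n∸m≡n m n) (∸-monoˡ-≤ m t≤m+n)

  short-window : ShortZeroSumWindow G n m
  short-window T m≤|T| |T|≤m+n with consecutive (length T ∸ m) (∸m≤n |T|≤m+n)
  ... | inj₁ (_ , _ , inC₀) = inC₀ T (≡.sym (m+[n∸m]≡n m≤|T|))
  ... | inj₂ m+[|T|∸m]≡e    =
    λ _ → eta T (≤-reflexive (≡.trans (≡.sym m+[|T|∸m]≡e) (m+[n∸m]≡n m≤|T|)))

  short-from : ShortZeroSumFrom G n m
  short-from = window⇒from G n 1≤n short-window
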